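{- Work in a theory containing identity types, the rules $\Pi$-form, $\Pi$-abs, $\Pi$-app and $\Pi$-$\beta$, and the rules $\Pi$-prop-$\eta$ and $\Pi$-prop-$\eta$-comp (all as described in the context). Then the rules $\Pi$-elim and $\Pi$-comp are definable. That is, for any $A\ \mathsf{type}$, $x:A\vdash B(x)\ \mathsf{type}$, $y:\Pi(A,B)\vdash C(y)\ \mathsf{type}$, $f:(x:A)\,B(x)\vdash d(f):C(\lambda(f))$ and $m:\Pi(A,B)$, one can define a term $\mathsf{funsplit}(d,m):C(m)$ such that, for every $x:A\vdash g(x):B(x)$, $\mathsf{funsplit}(d,\lambda(g))=d(g):C(\lambda(g))$ holds definitionally.
   Context: We work in intensional Martin-Löf type theory presented inside the Logical Framework, so rules may have higher-order premises such as $f:(x:A)\,B(x)$ (a meta-level function sending elements $x$ of $A$ to elements of $B(x)$), with meta-level abstraction $[x:A]\,b(x)$ and application $f(a)$ obeying the $\alpha,\beta,\eta,\xi$ rules. All rules hold in an arbitrary ambient context and are stable under substitution. A rule is called definable relative to some given rules if one can construct, from those rules, terms realising its conclusion so that all its stated definitional (judgemental) equalities hold. Identity types: for $A\ \mathsf{type}$ and $a,b:A$ there is a type $\mathsf{Id}_A(a,b)$; for $a:A$ there is $r(a):\mathsf{Id}_A(a,a)$; elimination: given $x,y:A,\ z:\mathsf{Id}_A(x,y)\vdash C(x,y,z)\ \mathsf{type}$, $x:A\vdash d(x):C(x,x,r(x))$, $a,b:A$ and $p:\mathsf{Id}_A(a,b)$, there is $J(d,a,b,p):C(a,b,p)$,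 with computation rule $J(d,a,a,r(a))=d(a)$. $\Pi$-types: $\Pi$-form: from $A\ \mathsf{type}$ and $x:A\vdash B(x)\ \mathsf{type}$ form $\Pi(A,B)\ \mathsf{type}$. $\Pi$-abs: from $x:A\vdash f(x):B(x)$ form $\lambda(f):\Pi(A,B)$. $\Pi$-app: from $m:\Pi(A,B)$, $a:A$ form $\mathsf{app}(m,a):B(a)$, also written $m\cdot a$. $\Pi$-$\beta$: $\mathsf{app}(\lambda(f),a)=f(a)$. We write $\lambda x.\,t(x)$ for $\lambda([x:A]\,t(x))$. $\Pi$-prop-$\eta$: for $m:\Pi(A,B)$ there is $\eta(m):\mathsf{Id}_{\Pi(A,B)}(m,\lambda x.\,m\cdot x)$. $\Pi$-prop-$\eta$-comp: for $x:A\vdash f(x):B(x)$, $\eta(\lambda(f))=r(\lambda(f))$. $\Pi$-elim and $\Pi$-comp are the rules stated in the claim (with $\mathsf{funsplit}$). -}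

module Defs where

open import Relation.Binary.PropositionalEquality using (_≡_)
open import Relation.Binary.HeterogeneousEquality using (_≅_)

-- A model of (the relevant fragment of) intensional Martin-Löf type theory
-- presented in the Logical Framework, by higher-order abstract syntax:
-- the LF function space is Agda's function space, a type family in
-- context  x : A  is an Agda function  Tm A → Ty,  and definitional
-- (judgemental) equality is interpreted as Agda's propositional
-- equality _≡_ (heterogeneous equality _≅_ where the two sides live in
-- types that are only judgementally, not syntactically, equal).
-- The ambient context is the Agda context, so stability under
-- substitution is automatic.
record Theory : Set₁ where
  field
    Ty : Set
    Tm : Ty → Set

    Id   : (A : Ty) → Tm A → Tm A → Ty
    r    : {A : Ty} (a : Tm A) → Tm (Id A a a)
    J    : {A : Ty} (C : (x y : Tm A) → Tm (Id A x y) → Ty)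
           (d : (x : Tm A) → Tm (C x x (r x)))
           (a b : Tm A) (p : Tm (Id A a b)) → Tm (C a b p)
    J-comp : {A : Ty} (C : (x y : Tm A) → Tm (Id A x y) → Ty)
             (d : (x : Tm A) → Tm (C x x (r x))) (a : Tm A) →
             J C d a a (r a) ≡ d a

    Π    : (A : Ty) → (Tm A → Ty) → Ty
    lam  : {A : Ty} {B : Tm A → Ty} → ((x : Tm A) → Tm (B x)) → Tm (Π A B)
    app  : {A : Ty} {B : Tm A → Ty} → Tm (Π A B) → (a : Tm A) → Tm (B a)

    -- Π-β, as a judgemental equality in the context  x : A
    -- (by the ξ-rule this is an equality of LF-abstractions
    --  [x:A] app(λ(f), x) = [x:A] f(x) = f).
    Π-β  : {A : Ty} {B : Tm A → Ty} (f : (x : Tm A) → Tm (B x)) →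
           (λ x → app (lam f) x) ≡ f

    η    : {A : Ty} {B : Tm A → Ty} (m : Tm (Π A B)) →
           Tm (Id (Π A B) m (lam (λ x → app m x)))
    η-comp : {A : Ty} {B : Tm A → Ty} (f : (x : Tm A) → Tm (B x)) →
             η (lam f) ≅ r (lam f)

-- Transporting backwards along a path (J into the motive C(y) → C(x))
-- is the identity on r. funsplit(d, m) transports
-- d([x] m·x) : C(λx. m·x) back along η(m). On m = λ(g), Π-β identifies
-- [x] λ(g)·x with g and η-comp turns η(λ(g)) into r(λ(g)), where the
-- transport computes away.
module Submission where

open import Defs
open import Data.Product using (Σ; _,_)
open import Relation.Binary.PropositionalEquality using (_≡_; refl; cong; cong-app; module ≡-Reasoning)
open import Relation.Binary.HeterogeneousEquality using (_≅_; ≅-to-≡)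

module _ (T : Theory) where
  open Theory T

  transport⁻-motive : {A : Ty} (C : Tm A → Ty) (x y : Tm A) → Tm (Id A x y) → Ty
  transport⁻-motive C x y _ = Π (C y) (λ _ → C x)

  transport⁻ : {A : Ty} (C : Tm A → Ty) {a b : Tm A} →
               Tm (Id A a b) → Tm (C b) → Tm (C a)
  transport⁻ C {a} {b} p = app (J (transport⁻-motive C) (λ _ → lam (λ c → c)) a b p)

  transport⁻-r : {A : Ty} (C : Tm A → Ty) (a : Tm A) (c : Tm (C a)) →
                 transport⁻ C (r a) c ≡ c
  transport⁻-r C a c = begin
    app (J (transport⁻-motive C) (λ _ → lam (λ c → c)) a a (r a)) c
      ≡⟨ cong (λ t → app t c) (J-comp (transport⁻-motive C) (λ _ → lam (λ c → c)) a) ⟩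
    app (lam (λ c → c)) c
      ≡⟨ cong-app (Π-β (λ c → c)) c ⟩
    c ∎
    where open ≡-Reasoning

  funsplit : {A : Ty} {B : Tm A → Ty} (C : Tm (Π A B) → Ty)
             (d : (f : (x : Tm A) → Tm (B x)) → Tm (C (lam f)))
             (m : Tm (Π A B)) → Tm (C m)
  funsplit C d m = transport⁻ C (η m) (d (λ x → app m x))

  -- Generalising over the η-expansion h of λ(g) lets Π-β and η-comp be
  -- matched away, since neither equation holds on the nose.
  transport⁻-η-expansion :
    {A : Ty} {B : Tm A → Ty} (C : Tm (Π A B) → Ty)
    (d : (f : (x : Tm A) → Tm (B x)) → Tm (C (lam f)))
    (g h : (x : Tm A) → Tm (B x)) → h ≡ g →
    (p : Tm (Id (Π A B) (lam g) (lam h))) → p ≅ r (lam g) →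
    transport⁻ C p (d h) ≡ d g
  transport⁻-η-expansion C d g .g refl p p≅r with ≅-to-≡ p≅r
  ... | refl = transport⁻-r C (lam g) (d g)

  funsplit-comp : {A : Ty} {B : Tm A → Ty} (C : Tm (Π A B) → Ty)
                  (d : (f : (x : Tm A) → Tm (B x)) → Tm (C (lam f)))
                  (g : (x : Tm A) → Tm (B x)) →
                  funsplit C d (lam g) ≡ d g
  funsplit-comp C d g =
    transport⁻-η-expansion C d g (λ x → app (lam g) x) (Π-β g) (η (lam g)) (η-comp g)

proposition3p7 : (T : Theory) → let open Theory T in
    Σ ({A : Ty} {B : Tm A → Ty} (C : Tm (Π A B) → Ty)
        (d : (f : (x : Tm A) → Tm (B x)) → Tm (C (lam f)))
        (m : Tm (Π A B)) → Tm (C m))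
      (λ funsplit →
        {A : Ty} {B : Tm A → Ty} (C : Tm (Π A B) → Ty)
        (d : (f : (x : Tm A) → Tm (B x)) → Tm (C (lam f)))
        (g : (x : Tm A) → Tm (B x)) →
        funsplit C d (lam g) ≡ d g)
proposition3p7 T = funsplit T , funsplit-comp T
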